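{- Let $w,u$ be words over $\{0,1\}$ of the same length $\ell\ge2$. Every cycle of the permutations $S_0(w)$ and $S_1(w)$ of $\{0,1\}^\ell$ has length a power of $2$. Furthermore, for all $a,b,c\in\{0,1\}$, either $\Lambda_c(aw)(bu)=\Lambda_c(w)(u)$ or $\Lambda_c(aw)(bu)=2\Lambda_c(w)(u)$.
   Context: For words $w=w_1\cdots w_\ell$, $u=u_1\cdots u_\ell$ over $\{0,1\}$ and $a\in\{0,1\}$, $S_a(w)(u)\in\{0,1\}^\ell$ is the word with $\ell$-th letter $u_\ell$ and $i$-th letter $u_i\oplus(u_{i+1}\wedge[w_{i+1}=a])$ for $1\le i\le\ell-1$ ($[\cdot]$ the indicator; $\oplus,\wedge$ XOR/AND). $S_a(w)$ is a bijection of $\{0,1\}^\ell$. $\Lambda_a(w)(u)$ denotes the length of the cycle of $S_a(w)$ containing $u$, i.e. the least $m\ge1$ with $S_a(w)^m(u)=u$. For letters $a,b$, $aw$ and $bu$ denote concatenation. -}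

module Defs where

open import Data.Bool using (Bool; _xor_; _∧_)
open import Data.Bool.Properties using (_≟_)
open import Data.Nat using (ℕ; zero; suc; _≤_; _<_)
open import Data.Vec using (Vec; []; _∷_)
open import Data.Product using (_×_)
open import Relation.Binary.PropositionalEquality using (_≡_; _≢_)
open import Relation.Nullary.Decidable using (isYes)

-- Words of length ℓ over {0,1} are Vec Bool ℓ (false = 0, true = 1).

S : ∀ {ℓ} → Bool → Vec Bool ℓ → Vec Bool ℓ → Vec Bool ℓ
S a [] [] = []
S a (w₁ ∷ []) (u₁ ∷ []) = u₁ ∷ []
S a (w₁ ∷ w₂ ∷ ws) (u₁ ∷ u₂ ∷ us) =
  (u₁ xor (u₂ ∧ isYes (w₂ ≟ a))) ∷ S a (w₂ ∷ ws) (u₂ ∷ us)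

iter : ∀ {A : Set} → (A → A) → ℕ → A → A
iter f zero x = x
iter f (suc m) x = f (iter f m x)

IsCycleLength : ∀ {A : Set} → (A → A) → A → ℕ → Set
IsCycleLength f x m =
  (1 ≤ m) × (iter f m x ≡ x) × (∀ k → 1 ≤ k → k < m → iter f k x ≢ x)

Λ≡ : ∀ {ℓ} → Bool → Vec Bool ℓ → Vec Bool ℓ → ℕ → Set
Λ≡ a w u m = IsCycleLength (S a w) u m

{-# OPTIONS --safe #-}
module Submission where

-- Dropping the first letter, S_c(aw) acts on bu as S_c(w) acts on u, while the
-- first letter is xored with a carry bit that depends only on the current tail.
-- So once the tail has gone round its cycle of length m = Λ_c(w)(u), the first
-- letter has been xored with a total carry d that does not depend on it: the
-- cycle of bu closes after m steps if d = 0 and after 2m steps if d = 1.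
-- Starting from words of length 1, on which S_c is the identity, induction on
-- the length shows that all cycle lengths are powers of 2.

open import Defs
open import Data.Bool using (Bool; true; false; _xor_; _∧_)
open import Data.Bool.Properties using (_≟_; xor-assoc; xor-comm; xor-identityʳ; not-¬)
open import Data.Nat using (ℕ; zero; suc; _≤_; _<_; _^_; _*_; _+_; s≤s; z≤n)
open import Data.Nat.Properties
  using (<-cmp; <⇒≱; ≤-trans; m≤m+n; +-comm; +-identityʳ; +-suc; +-cancelˡ-<; m≤n⇒∃[o]m+o≡n)
open import Data.Vec using (Vec; []; _∷_; head; tail)
open import Data.Product using (_×_; ∃; _,_)
open import Data.Sum using (_⊎_; inj₁; inj₂) renaming (map to ⊎-map)
open import Data.Empty using (⊥-elim)
open import Function using (_∘_)
open import Relation.Binary.Definitions using (tri<; tri≈; tri>)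
open import Relation.Binary.PropositionalEquality
  using (_≡_; _≢_; refl; sym; trans; cong; subst; module ≡-Reasoning)
open import Relation.Nullary.Decidable using (isYes)
open ≡-Reasoning

iter-+ : ∀ {A : Set} (f : A → A) j k x → iter f (j + k) x ≡ iter f j (iter f k x)
iter-+ f zero    k x = refl
iter-+ f (suc j) k x = cong f (iter-+ f j k x)

iter-periodic : ∀ {A : Set} (f : A → A) m {x} → iter f m x ≡ x →
                ∀ k → iter f (m + k) x ≡ iter f k x
iter-periodic f m {x} fᵐx≡x k = begin
  iter f (m + k) x         ≡⟨ cong (λ j → iter f j x) (+-comm m k) ⟩
  iter f (k + m) x         ≡⟨ iter-+ f k m x ⟩
  iter f k (iter f m x)    ≡⟨ cong (iter f k) fᵐx≡x ⟩
  iter f k x               ∎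

cycleLength-unique : ∀ {A : Set} {f : A → A} {x m n} →
                     IsCycleLength f x m → IsCycleLength f x n → m ≡ n
cycleLength-unique {m = m} {n} (1≤m , fᵐx≡x , minimalₘ) (1≤n , fⁿx≡x , minimalₙ)
  with <-cmp m n
... | tri< m<n _ _ = ⊥-elim (minimalₙ m 1≤m m<n fᵐx≡x)
... | tri≈ _ m≡n _ = m≡n
... | tri> _ _ n<m = ⊥-elim (minimalₘ n 1≤n n<m fⁿx≡x)

module Semiconjugacy {A B : Set} (f : A → A) (g : B → B) (p : A → B)
                     (p∘f≗g∘p : ∀ x → p (f x) ≡ g (p x)) where

  iter-semiconj : ∀ k x → p (iter f k x) ≡ iter g k (p x)
  iter-semiconj zero    x = refl
  iter-semiconj (suc k) x = trans (p∘f≗g∘p (iter f k x)) (cong g (iter-semiconj k x))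

  iter-fixed-proj : ∀ k {x} → iter f k x ≡ x → iter g k (p x) ≡ p x
  iter-fixed-proj k {x} fᵏx≡x = trans (sym (iter-semiconj k x)) (cong p fᵏx≡x)

  cycleLength-lift : ∀ {x m} → IsCycleLength g (p x) m →
                     iter f m x ≡ x → IsCycleLength f x m
  cycleLength-lift (1≤m , _ , minimal) fᵐx≡x =
    1≤m , fᵐx≡x , λ k 1≤k k<m → minimal k 1≤k k<m ∘ iter-fixed-proj k

  cycleLength-lift-double : ∀ {x m} → IsCycleLength g (p x) m →
                            iter f m x ≢ x → iter f (m + m) x ≡ x →
                            IsCycleLength f x (2 * m)
  cycleLength-lift-double {x} {m} (1≤m , gᵐ≡id , minimal) fᵐx≢x f²ᵐx≡x =
    subst (IsCycleLength f x) (sym 2*m≡m+m)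
      (≤-trans 1≤m (m≤m+n m m) , f²ᵐx≡x , minimal₂)
    where
    2*m≡m+m : 2 * m ≡ m + m
    2*m≡m+m = cong (m +_) (+-identityʳ m)

    minimal₂ : ∀ k → 1 ≤ k → k < m + m → iter f k x ≢ x
    minimal₂ k 1≤k k<2m fᵏx≡x with <-cmp k m
    ... | tri< k<m _ _ = minimal k 1≤k k<m (iter-fixed-proj k fᵏx≡x)
    ... | tri≈ _ refl _ = fᵐx≢x fᵏx≡x
    ... | tri> _ _ m<k with m≤n⇒∃[o]m+o≡n m<k
    ...   | o , refl =
      minimal (suc o) (s≤s z≤n) 1+o<m
        (trans (sym (iter-periodic g m gᵐ≡id (suc o))) (iter-fixed-proj (m + suc o) fᵐ⁺¹⁺ᵒx≡x))
      where
      k≡m+1+o : suc m + o ≡ m + suc o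
      k≡m+1+o = sym (+-suc m o)

      1+o<m : suc o < m
      1+o<m = +-cancelˡ-< m (suc o) m (subst (_< m + m) k≡m+1+o k<2m)

      fᵐ⁺¹⁺ᵒx≡x : iter f (m + suc o) x ≡ x
      fᵐ⁺¹⁺ᵒx≡x = subst (λ j → iter f j x ≡ x) k≡m+1+o fᵏx≡x

carry : ∀ {n} → Bool → Vec Bool (suc n) → Vec Bool (suc n) → Bool
carry c w u = head u ∧ isYes (head w ≟ c)

S-cons : ∀ {n} c a x (w u : Vec Bool (suc n)) →
         S c (a ∷ w) (x ∷ u) ≡ (x xor carry c w u) ∷ S c w u
S-cons c a x (w₁ ∷ ws) (u₁ ∷ us) = refl

tail-S-cons : ∀ {n} c a (w : Vec Bool (suc n)) z → tail (S c (a ∷ w) z) ≡ S c w (tail z)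
tail-S-cons c a w (x ∷ u) = cong tail (S-cons c a x w u)

carries : ∀ {n} → Bool → Vec Bool (suc n) → ℕ → Vec Bool (suc n) → Bool
carries c w zero    u = false
carries c w (suc k) u = carries c w k u xor carry c w (iter (S c w) k u)

iter-S-cons : ∀ {n} c a (w u : Vec Bool (suc n)) k x →
              iter (S c (a ∷ w)) k (x ∷ u) ≡ (x xor carries c w k u) ∷ iter (S c w) k u
iter-S-cons c a w u zero    x = cong (_∷ u) (sym (xor-identityʳ x))
iter-S-cons {n} c a w u (suc k) x = begin
  S c (a ∷ w) (iter (S c (a ∷ w)) k (x ∷ u))
    ≡⟨ cong (S c (a ∷ w)) (iter-S-cons c a w u k x) ⟩
  S c (a ∷ w) ((x xor carries c w k u) ∷ uₖ)
    ≡⟨ S-cons c a (x xor carries c w k u) w uₖ ⟩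
  ((x xor carries c w k u) xor carry c w uₖ) ∷ S c w uₖ
    ≡⟨ cong (_∷ S c w uₖ) (xor-assoc x (carries c w k u) (carry c w uₖ)) ⟩
  (x xor carries c w (suc k) u) ∷ S c w uₖ
    ∎
  where
  uₖ : Vec Bool (suc n)
  uₖ = iter (S c w) k u

cycleLength-cons : ∀ {n} c a b (w u : Vec Bool (suc n)) {m} → Λ≡ c w u m →
                   Λ≡ c (a ∷ w) (b ∷ u) m ⊎ Λ≡ c (a ∷ w) (b ∷ u) (2 * m)
cycleLength-cons {n} c a b w u {m} cl@(_ , Sᵐu≡u , _) =
  closeAfter (carries c w m u) Tᵐx≡x⊕carries
  where
  open Semiconjugacy (S c (a ∷ w)) (S c w) tail (tail-S-cons c a w)

  T : Vec Bool (suc (suc n)) → Vec Bool (suc (suc n))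
  T = S c (a ∷ w)

  Tᵐx≡x⊕carries : ∀ x → iter T m (x ∷ u) ≡ (x xor carries c w m u) ∷ u
  Tᵐx≡x⊕carries x = trans (iter-S-cons c a w u m x) (cong ((x xor carries c w m u) ∷_) Sᵐu≡u)

  closeAfter : ∀ d → (∀ x → iter T m (x ∷ u) ≡ (x xor d) ∷ u) →
               Λ≡ c (a ∷ w) (b ∷ u) m ⊎ Λ≡ c (a ∷ w) (b ∷ u) (2 * m)
  closeAfter false Tᵐx≡x⊕d =
    inj₁ (cycleLength-lift cl (trans (Tᵐx≡x⊕d b) (cong (_∷ u) (xor-identityʳ b))))
  closeAfter true  Tᵐx≡x⊕d = inj₂ (cycleLength-lift-double cl Tᵐbu≢bu T²ᵐbu≡bu)
    where
    Tᵐbu≢bu : iter T m (b ∷ u) ≢ b ∷ u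
    Tᵐbu≢bu eq = not-¬ refl (trans (sym b⊕1≡b) (xor-comm b true))
      where
      b⊕1≡b : b xor true ≡ b
      b⊕1≡b = cong head (trans (sym (Tᵐx≡x⊕d b)) eq)

    T²ᵐbu≡bu : iter T (m + m) (b ∷ u) ≡ b ∷ u
    T²ᵐbu≡bu = begin
      iter T (m + m) (b ∷ u)           ≡⟨ iter-+ T m m (b ∷ u) ⟩
      iter T m (iter T m (b ∷ u))      ≡⟨ cong (iter T m) (Tᵐx≡x⊕d b) ⟩
      iter T m ((b xor true) ∷ u)      ≡⟨ Tᵐx≡x⊕d (b xor true) ⟩
      ((b xor true) xor true) ∷ u      ≡⟨ cong (_∷ u) (xor-assoc b true true) ⟩
      (b xor false) ∷ u                ≡⟨ cong (_∷ u) (xor-identityʳ b) ⟩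
      b ∷ u                            ∎

cycleLength-pow2 : ∀ {n} c (w u : Vec Bool (suc n)) → ∃ λ k → Λ≡ c w u (2 ^ k)
cycleLength-pow2 c (w₁ ∷ []) (u₁ ∷ []) = 0 , s≤s z≤n , refl , λ k 1≤k k<1 _ → <⇒≱ k<1 1≤k
cycleLength-pow2 c (a ∷ w@(_ ∷ _)) (b ∷ u) with cycleLength-pow2 c w u
... | k , cl with cycleLength-cons c a b w u cl
...   | inj₁ cl′ = k , cl′
...   | inj₂ cl′ = suc k , cl′

theorem6p2 : ∀ (ℓ : ℕ) → 2 ≤ ℓ → (w u : Vec Bool ℓ) →
    ((a : Bool) → (v : Vec Bool ℓ) → ∃ λ k → Λ≡ a w v (2 ^ k))
    × ((a b c : Bool) → (m m′ : ℕ) → Λ≡ c w u m → Λ≡ c (a ∷ w) (b ∷ u) m′ →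
    (m′ ≡ m) ⊎ (m′ ≡ 2 * m))
theorem6p2 (suc ℓ) _ w u =
  (λ a v → cycleLength-pow2 a w v) ,
  λ a b c m m′ cl cl′ →
    ⊎-map (cycleLength-unique cl′) (cycleLength-unique cl′) (cycleLength-cons c a b w u cl)
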